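{- Let $u\in V^2$ and set $U:=(V\setminus\{u_1\})\times(V\setminus\{u_2\})$. Let $f:V^2\to V$ be a binary injection which preserves $E$ and $N$, behaves like $p_1$ between all points $v,w\in U$, and behaves like $\min$ between $u$ and every point of $U$. Then $f$ generates a binary injection of type $\min$.
   Context: $G=(V;E)$ is the random (Rado) graph: the unique countably infinite homogeneous graph into which every finite graph embeds. $N(x,y)$ iff $x\neq y$ and $\neg E(x,y)$. $f$ preserves $E$ if $E(a_1,b_1)\wedge E(a_2,b_2)$ implies $E(f(a),f(b))$; likewise for $N$. $f$ behaves like $p_1$ between points $a,b\in V^2$ if, whenever $a_1\neq b_1$ and $a_2\neq b_2$, we have $E(f(a),f(b))$ iff $E(a_1,b_1)$; it behaves like $\min$ between $a,b$ if, whenever $a_1\neq b_1$ and $a_2\neq b_2$, $E(f(a),f(b))$ iff $E(a_1,b_1)\wedge E(a_2,b_2)$. A binary injection is of type $\min$ if it behaves like $\min$ between all $a,b\in V^2$. $f$ generates $g$ if $g$ lies in the smallest set of finitary operations on $V$ containing $f$, all automorphisms of $G$ and all projections, closed under composition and locally closed (containing every $k$-ary $g$ such that for every finite $A\subseteq V^k$ some member agrees with $g$ on $A$). -}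

module Defs where

open import Data.Nat using (ℕ; zero; suc; _%_; _/_)
open import Data.Fin using (Fin; zero; suc)
open import Data.Product using (Σ; _×_; _,_; proj₁; proj₂)
open import Data.Sum using (_⊎_)
open import Data.List using (List)
open import Data.List.Membership.Propositional using (_∈_)
open import Relation.Binary.PropositionalEquality using (_≡_; _≢_)
open import Relation.Nullary using (¬_)
open import Function.Bundles using (_⇔_)
open import Function.Definitions using (Injective)

-- The random (Rado) graph, in Rado's/Ackermann's concrete presentation:
-- vertex set ℕ; for i < j, i and j are adjacent iff the i-th binary
-- digit of j is 1.

Bit : ℕ → ℕ → Set
Bit zero    n = n % 2 ≡ 1
Bit (suc i) n = Bit i (n / 2)

V : Set
V = ℕ

-- Edge relation (irreflexive, symmetric).  When i > j, Bit i j never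
-- holds (j < 2^i), so this is exactly the symmetrisation of the rule above.
E : V → V → Set
E x y = x ≢ y × (Bit x y ⊎ Bit y x)

N : V → V → Set
N x y = x ≢ y × ¬ E x y

V² : Set
V² = V × V

Preserves : (V → V → Set) → (V² → V) → Set
Preserves R f = ∀ (a b : V²) → R (proj₁ a) (proj₁ b) → R (proj₂ a) (proj₂ b) → R (f a) (f b)

BehavesP1 : (V² → V) → V² → V² → Set
BehavesP1 f a b = proj₁ a ≢ proj₁ b → proj₂ a ≢ proj₂ b →
  (E (f a) (f b) ⇔ E (proj₁ a) (proj₁ b))

BehavesMin : (V² → V) → V² → V² → Set
BehavesMin f a b = proj₁ a ≢ proj₁ b → proj₂ a ≢ proj₂ b →
  (E (f a) (f b) ⇔ (E (proj₁ a) (proj₁ b) × E (proj₂ a) (proj₂ b)))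

BinaryInjection : (V² → V) → Set
BinaryInjection f = Injective _≡_ _≡_ f

TypeMin : (V² → V) → Set
TypeMin f = BinaryInjection f × (∀ a b → BehavesMin f a b)

InU : V² → V² → Set
InU u v = proj₁ v ≢ proj₁ u × proj₂ v ≢ proj₂ u

IsAut : (V → V) → Set
IsAut α = Σ (V → V) λ β →
  (∀ x → β (α x) ≡ x) × (∀ x → α (β x) ≡ x) ×
  (∀ x y → E x y ⇔ E (α x) (α y))

Op : ℕ → Set
Op k = (Fin k → V) → V

data Gen (f : V² → V) : (k : ℕ) → Op k → Set where
  gen-f    : Gen f 2 (λ x → f (x zero , x (suc zero)))
  gen-aut  : (α : V → V) → IsAut α → Gen f 1 (λ x → α (x zero))
  gen-proj : (k : ℕ) (i : Fin k) → Gen f k (λ x → x i)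
  gen-comp : (n k : ℕ) (g : Op n) (hs : Fin n → Op k) →
             Gen f n g → (∀ i → Gen f k (hs i)) →
             Gen f k (λ x → g (λ i → hs i x))
  gen-local : (k : ℕ) (g : Op k) →
             (∀ (A : List (Fin k → V)) →
                Σ (Op k) λ h → Gen f k h × (∀ a → a ∈ A → h a ≡ g a)) →
             Gen f k g

Generates : (V² → V) → (V² → V) → Set
Generates f g = Gen f 2 (λ x → g (x zero , x (suc zero)))

{-# OPTIONS --safe #-}

-- A forth argument gives an embedding e of G into itself avoiding u₁ and u₂,
-- so g₁(x , y) = f(e x , e y) behaves like p₁ and g₂(x , y) = g₁(y , x) like
-- p₂ everywhere; composing (g₁ , g₂) with a binary injection M of type min
-- (again built by a forth argument) gives g of type min.  By local closure and
-- the homogeneity of G it suffices to produce, for each finite A ⊆ V², an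
-- operation generated by f with the same isomorphism type as g on A.  Start
-- from g₁ and treat the points a ∈ A in turn, replacing the current H by
-- f(α ∘ H , β ∘ g₂) where automorphisms α, β send H a to u₁ and g₂ a to u₂:
-- f then behaves like min between a and the other points of A and like p₁
-- among them, so the edges at a become the min-edges of (g₁ , g₂) while all
-- others are kept.

module Submission where

open import Defs
open import Data.Bool using (Bool; true; false)
open import Data.Empty using (⊥-elim)
open import Data.Fin using (Fin; zero; suc)
open import Data.List using (List; []; _∷_; _++_; map; filter)
open import Data.List.Extrema.Nat using (max; xs≤max)
open import Data.List.Membership.Propositional using (_∈_; _∉_; lose; find)
open import Data.List.Membership.Propositional.Properties using (∈-++⁺ˡ; ∈-++⁺ʳ; ∈-map⁺; ∈-map⁻; ∈-filter⁺; ∈-filter⁻)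
import Data.List.Membership.DecPropositional as DecMembership
open import Data.List.Relation.Binary.Subset.Propositional using (_⊆_)
open import Data.List.Relation.Unary.All using (lookup)
open import Data.List.Relation.Unary.Any using (here; there; any?)
open import Data.Nat using (ℕ; zero; suc; _+_; _*_; _%_; _/_; _≤_; _<_; _≤′_; ≤′-refl; ≤′-step; _⊔_; z≤n; s≤s; _≟_)
open import Data.Nat.DivMod using ([m+kn]%n≡m%n; m<n⇒m%n≡m; m<n⇒m/n≡0; m*n/n≡m; +-distrib-/-∣ʳ; m/n*n≤m)
open import Data.Nat.Divisibility using (divides-refl)
open import Data.Nat.Properties using (≤-refl; ≤-trans; <-trans; <-irrefl; <-asym; m≤m*n; *-monoˡ-≤; ≤⇒≤′; m≤m⊔n; m≤n⊔m; +-identityʳ; +-suc)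
open import Data.Product using (Σ; _×_; _,_; proj₁; proj₂; swap)
open import Data.Product.Function.NonDependent.Propositional using (_×-⇔_)
open import Data.Product.Properties using (×-≡,≡→≡; ×-≡,≡←≡; ≡-dec)
open import Data.Sum using (_⊎_; inj₁; inj₂)
open import Function using (_∘_; id; const)
open import Function.Bundles using (_⇔_; mk⇔; Equivalence)
open import Function.Definitions using (Injective)
open import Function.Properties.Equivalence using (⇔-setoid) renaming (trans to ⇔-trans)
open import Level using (0ℓ)
open import Relation.Binary.PropositionalEquality using (_≡_; _≢_; refl; sym; trans; cong; cong₂; subst)
import Relation.Binary.Reasoning.Setoid as SetoidReasoning
open import Relation.Nullary using (¬_; Dec; does; yes; no)
open import Relation.Nullary.Decidable using (dec-true; ¬?; _×-dec_; _⊎-dec_; decidable-stable)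

open DecMembership _≟_ using (_∈?_)

module ⇔-Reasoning = SetoidReasoning (⇔-setoid 0ℓ)

-- The extension property of G

does≡true⇒ : ∀ {A : Set} (a? : Dec A) → does a? ≡ true → A
does≡true⇒ (yes a) _ = a

bitValue : Bool → ℕ
bitValue false = 0
bitValue true  = 1

bitValue<2 : ∀ b → bitValue b < 2
bitValue<2 false = s≤s z≤n
bitValue<2 true  = s≤s (s≤s z≤n)

bitValue≡1 : ∀ {b} → bitValue b ≡ 1 → b ≡ true
bitValue≡1 {true} _ = refl

[b+n*2]%2≡b : ∀ b n → (bitValue b + n * 2) % 2 ≡ bitValue b
[b+n*2]%2≡b b n = trans ([m+kn]%n≡m%n (bitValue b) n 2) (m<n⇒m%n≡m (bitValue<2 b))

[b+n*2]/2≡n : ∀ b n → (bitValue b + n * 2) / 2 ≡ n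
[b+n*2]/2≡n b n = trans (+-distrib-/-∣ʳ (bitValue b) (divides-refl n))
                        (cong₂ _+_ (m<n⇒m/n≡0 (bitValue<2 b)) (m*n/n≡m n 2))

fromDigits : (ℕ → Bool) → ℕ → ℕ
fromDigits d zero    = 0
fromDigits d (suc k) = bitValue (d 0) + fromDigits (d ∘ suc) k * 2

¬Bit-0 : ∀ i → ¬ Bit i 0
¬Bit-0 zero    ()
¬Bit-0 (suc i) b = ¬Bit-0 i b

Bit⇒< : ∀ i n → Bit i n → i < n
Bit⇒< zero    zero    b = ⊥-elim (¬Bit-0 0 b)
Bit⇒< zero    (suc n) b = s≤s z≤n
Bit⇒< (suc i) n       b =
  ≤-trans (s≤s (s≤s (m≤m*n i 2))) (≤-trans (*-monoˡ-≤ 2 (Bit⇒< i (n / 2) b)) (m/n*n≤m n 2))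

Bit-fromDigits⁺ : ∀ i d k → i < k → d i ≡ true → Bit i (fromDigits d k)
Bit-fromDigits⁺ zero    d (suc k) _ di =
  trans ([b+n*2]%2≡b (d 0) (fromDigits (d ∘ suc) k)) (cong bitValue di)
Bit-fromDigits⁺ (suc i) d (suc k) (s≤s i<k) di =
  subst (Bit i) (sym ([b+n*2]/2≡n (d 0) (fromDigits (d ∘ suc) k))) (Bit-fromDigits⁺ i (d ∘ suc) k i<k di)

Bit-fromDigits⁻ : ∀ i d k → Bit i (fromDigits d k) → d i ≡ true
Bit-fromDigits⁻ i       d zero    b = ⊥-elim (¬Bit-0 i b)
Bit-fromDigits⁻ zero    d (suc k) b = bitValue≡1 (trans (sym ([b+n*2]%2≡b (d 0) (fromDigits (d ∘ suc) k))) b)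
Bit-fromDigits⁻ (suc i) d (suc k) b =
  Bit-fromDigits⁻ i (d ∘ suc) k (subst (Bit i) ([b+n*2]/2≡n (d 0) (fromDigits (d ∘ suc) k)) b)

record Extension (P W : List V) : Set where
  field
    vertex      : V
    adjacent    : ∀ {a} → a ∈ P → E vertex a
    fresh       : ∀ {a} → a ∈ W → vertex ≢ a
    nonAdjacent : ∀ {a} → a ∈ W → a ∉ P → ¬ E vertex a

-- The witness has binary digits exactly at P and at a position K exceeding
-- every vertex in sight, so it is larger than all of them.
extension : (P W : List V) → Extension P W
extension P W = record
  { vertex = z ; adjacent = adjacent ; fresh = λ a∈W → <⇒≢z (W<K a∈W) ; nonAdjacent = nonAdjacent }
  where
  K : ℕ
  K = suc (max 0 (P ++ W))

  digits : ℕ → Bool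
  digits i = does (i ∈? K ∷ P)

  z : V
  z = fromDigits digits (suc K)

  P<K : ∀ {a} → a ∈ P → a < K
  P<K a∈P = s≤s (lookup (xs≤max 0 (P ++ W)) (∈-++⁺ˡ a∈P))

  W<K : ∀ {a} → a ∈ W → a < K
  W<K a∈W = s≤s (lookup (xs≤max 0 (P ++ W)) (∈-++⁺ʳ P a∈W))

  digit⁺ : ∀ {a} → a ∈ K ∷ P → digits a ≡ true
  digit⁺ {a} = dec-true (a ∈? K ∷ P)

  digit⁻ : ∀ {a} → digits a ≡ true → a ∈ K ∷ P
  digit⁻ {a} = does≡true⇒ (a ∈? K ∷ P)

  K<z : K < z
  K<z = Bit⇒< K z (Bit-fromDigits⁺ K digits (suc K) ≤-refl (digit⁺ (here refl)))

  <⇒≢z : ∀ {a} → a < K → z ≢ a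
  <⇒≢z a<K z≡a = <-irrefl (sym z≡a) (<-trans a<K K<z)

  adjacent : ∀ {a} → a ∈ P → E z a
  adjacent a∈P = <⇒≢z (P<K a∈P)
               , inj₂ (Bit-fromDigits⁺ _ digits (suc K) (<-trans (P<K a∈P) ≤-refl) (digit⁺ (there a∈P)))

  nonAdjacent : ∀ {a} → a ∈ W → a ∉ P → ¬ E z a
  nonAdjacent a∈W a∉P (_ , inj₁ b) = <-asym (Bit⇒< z _ b) (<-trans (W<K a∈W) K<z)
  nonAdjacent {a} a∈W a∉P (_ , inj₂ b) with digit⁻ (Bit-fromDigits⁻ a digits (suc K) b)
  ... | here refl = <-irrefl refl (W<K a∈W)
  ... | there a∈P = a∉P a∈P

E-sym : ∀ {x y} → E x y → E y x
E-sym (x≢y , inj₁ b) = x≢y ∘ sym , inj₂ b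
E-sym (x≢y , inj₂ b) = x≢y ∘ sym , inj₁ b

E-sym⇔ : ∀ {x y} → E x y ⇔ E y x
E-sym⇔ = mk⇔ E-sym E-sym

E-irrefl : ∀ x → ¬ E x x
E-irrefl x (x≢x , _) = x≢x refl

Bit? : ∀ i n → Dec (Bit i n)
Bit? zero    n = n % 2 ≟ 1
Bit? (suc i) n = Bit? i (n / 2)

E? : ∀ x y → Dec (E x y)
E? x y = ¬? (x ≟ y) ×-dec (Bit? x y ⊎-dec Bit? y x)

_≟²_ : (a b : V²) → Dec (a ≡ b)
_≟²_ = ≡-dec _≟_ _≟_

-- Finite partial isomorphisms and the back-and-forth method

-- A finite partial map from (ℕ , R) to G is represented by its graph, a list
-- of (argument , image) pairs.
record Compatible (R : ℕ → ℕ → Set) (p q : ℕ × V) : Set where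
  field
    functional : proj₁ p ≡ proj₁ q → proj₂ p ≡ proj₂ q
    injective  : proj₂ p ≡ proj₂ q → proj₁ p ≡ proj₁ q
    preserves  : R (proj₁ p) (proj₁ q) → E (proj₂ p) (proj₂ q)
    reflects   : E (proj₂ p) (proj₂ q) → R (proj₁ p) (proj₁ q)

IsPartialIso : (ℕ → ℕ → Set) → List (ℕ × V) → Set
IsPartialIso R L = ∀ {p q} → p ∈ L → q ∈ L → Compatible R p q

Avoids : List V → List (ℕ × V) → Set
Avoids W L = ∀ {p} → p ∈ L → proj₂ p ∉ W

⊆-chain : ∀ {A : Set} (S : ℕ → List A) → (∀ n → S n ⊆ S (suc n)) → ∀ {m n} → m ≤ n → S m ⊆ S n
⊆-chain {A} S step {m} m≤n = go (≤⇒≤′ m≤n)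
  where
  go : ∀ {n} → m ≤′ n → S m ⊆ S n
  go ≤′-refl        = id
  go (≤′-step m≤n) = step _ ∘ go m≤n

chain-compatible : ∀ {R} (S : ℕ → List (ℕ × V)) → (∀ n → S n ⊆ S (suc n)) →
                   (∀ n → IsPartialIso R (S n)) →
                   ∀ {p q} i j → p ∈ S i → q ∈ S j → Compatible R p q
chain-compatible S step iso i j p∈ q∈ =
  iso (i ⊔ j) (⊆-chain S step (m≤m⊔n i j) p∈) (⊆-chain S step (m≤n⊔m i j) q∈)

module PartialIso {R : ℕ → ℕ → Set} (R? : ∀ x y → Dec (R x y))
                  (R-irrefl : ∀ x → ¬ R x x) (R-sym : ∀ {x y} → R x y → R y x) where

  Compatible-refl : ∀ p → Compatible R p p
  Compatible-refl (x , y) = record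
    { functional = λ _ → refl ; injective = λ _ → refl
    ; preserves = ⊥-elim ∘ R-irrefl x ; reflects = ⊥-elim ∘ E-irrefl y }

  Compatible-sym : ∀ {p q} → Compatible R p q → Compatible R q p
  Compatible-sym c = record
    { functional = sym ∘ functional ∘ sym ; injective = sym ∘ injective ∘ sym
    ; preserves = E-sym ∘ preserves ∘ R-sym ; reflects = R-sym ∘ reflects ∘ E-sym }
    where
      open Compatible c

  IsPartialIso-∷ : ∀ {p L} → (∀ {q} → q ∈ L → Compatible R p q) → IsPartialIso R L → IsPartialIso R (p ∷ L)
  IsPartialIso-∷ {p} new iso (here refl) (here refl) = Compatible-refl p
  IsPartialIso-∷     new iso (here refl) (there q∈) = new q∈
  IsPartialIso-∷     new iso (there p∈)  (here refl) = Compatible-sym (new p∈)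
  IsPartialIso-∷     new iso (there p∈)  (there q∈) = iso p∈ q∈

  record ForthStep (W : List V) (L : List (ℕ × V)) (x : ℕ) : Set where
    field
      image        : V
      graph        : List (ℕ × V)
      isPartialIso : IsPartialIso R graph
      avoids       : Avoids W graph
      maps         : (x , image) ∈ graph
      extends      : L ⊆ graph

  -- A new argument x is sent to a vertex adjacent exactly to the images of
  -- the R-neighbours of x, chosen by the extension property.
  forth : ∀ {W L} → IsPartialIso R L → Avoids W L → ∀ x → ForthStep W L x
  forth {W} {L} iso avoids x with any? (λ p → proj₁ p ≟ x) L
  ... | yes x∈dom with find x∈dom
  ...   | (_ , y) , xy∈L , refl = record
          { image = y ; graph = L ; isPartialIso = iso ; avoids = avoids ; maps = xy∈L ; extends = id }
  forth {W} {L} iso avoids x | no x∉dom = record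
    { image = vertex ; graph = (x , vertex) ∷ L ; isPartialIso = IsPartialIso-∷ new iso
    ; avoids = λ { (here refl) v∈W → fresh (∈-++⁺ʳ _ v∈W) refl ; (there p∈) → avoids p∈ }
    ; maps = here refl ; extends = there }
    where
    images-of-neighbours : List V
    images-of-neighbours = map proj₂ (filter (R? x ∘ proj₁) L)

    open Extension (extension images-of-neighbours (map proj₂ L ++ W))

    image-of-neighbour : ∀ {q} → q ∈ L → proj₂ q ∈ images-of-neighbours → R x (proj₁ q)
    image-of-neighbour q∈L y∈ with ∈-map⁻ proj₂ y∈
    ... | q′ , q′∈ , refl with ∈-filter⁻ (R? x ∘ proj₁) q′∈
    ...   | q′∈L , r = subst (R x) (Compatible.injective (iso q′∈L q∈L) refl) r

    new : ∀ {q} → q ∈ L → Compatible R (x , vertex) q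
    new q∈L = record
      { functional = λ x≡ → ⊥-elim (x∉dom (lose q∈L (sym x≡)))
      ; injective = λ v≡ → ⊥-elim (fresh (∈-++⁺ˡ (∈-map⁺ proj₂ q∈L)) v≡)
      ; preserves = λ r → adjacent (∈-map⁺ proj₂ (∈-filter⁺ (R? x ∘ proj₁) q∈L r))
      ; reflects = λ e → decidable-stable (R? x _) λ ¬r →
          nonAdjacent (∈-++⁺ˡ (∈-map⁺ proj₂ q∈L)) (¬r ∘ image-of-neighbour q∈L) e }

  record IsEmbedding (m : ℕ → V) : Set where
    field
      injective : Injective _≡_ _≡_ m
      edges     : ∀ i j → R i j ⇔ E (m i) (m j)

  embedding : (W : List V) → Σ (ℕ → V) λ m → IsEmbedding m × (∀ i → m i ∉ W)
  embedding W = m , record { injective = injective ; edges = edges } , avoiding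
    where
    stage : ℕ → Σ (List (ℕ × V)) λ L → IsPartialIso R L × Avoids W L
    step : ∀ n → ForthStep W (proj₁ (stage n)) n
    stage zero    = [] , (λ ()) , (λ ())
    stage (suc n) = ForthStep.graph (step n) , ForthStep.isPartialIso (step n) , ForthStep.avoids (step n)
    step n = let _ , iso , avoids = stage n in forth iso avoids n

    m : ℕ → V
    m n = ForthStep.image (step n)

    compatible : ∀ i j → Compatible R (i , m i) (j , m j)
    compatible i j = chain-compatible (proj₁ ∘ stage) (ForthStep.extends ∘ step) (proj₁ ∘ proj₂ ∘ stage)
                                      (suc i) (suc j) (ForthStep.maps (step i)) (ForthStep.maps (step j))

    injective : Injective _≡_ _≡_ m
    injective {i} {j} = Compatible.injective (compatible i j)

    edges : ∀ i j → R i j ⇔ E (m i) (m j)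
    edges i j = mk⇔ (Compatible.preserves (compatible i j)) (Compatible.reflects (compatible i j))

    avoiding : ∀ i → m i ∉ W
    avoiding i = proj₂ (proj₂ (stage (suc i))) (ForthStep.maps (step i))


open PartialIso E? E-irrefl E-sym

Compatible-swap : ∀ {p q} → Compatible E p q → Compatible E (swap p) (swap q)
Compatible-swap c = record
  { functional = injective ; injective = functional ; preserves = reflects ; reflects = preserves }
  where
    open Compatible c

IsPartialIso-swap : ∀ {L} → IsPartialIso E L → IsPartialIso E (map swap L)
IsPartialIso-swap iso p∈ q∈ with ∈-map⁻ swap p∈ | ∈-map⁻ swap q∈
... | _ , p′∈ , refl | _ , q′∈ , refl = Compatible-swap (iso p′∈ q′∈)

record BackAndForthStep (L : List (V × V)) (n : V) : Set where
  field
    image preimage : V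
    graph          : List (V × V)
    isPartialIso   : IsPartialIso E graph
    forward        : (n , image) ∈ graph
    backward       : (preimage , n) ∈ graph
    extends        : L ⊆ graph

-- The backward step is a forward step for the inverse partial map.
backAndForth : ∀ {L} → IsPartialIso E L → ∀ n → BackAndForthStep L n
backAndForth iso n = record
  { image = image s₁ ; preimage = image s₂ ; graph = map swap (graph s₂)
  ; isPartialIso = IsPartialIso-swap (isPartialIso s₂)
  ; forward = ∈-map⁺ swap (extends s₂ (∈-map⁺ swap (maps s₁)))
  ; backward = ∈-map⁺ swap (maps s₂)
  ; extends = ∈-map⁺ swap ∘ extends s₂ ∘ ∈-map⁺ swap ∘ extends s₁ }
  where
  open ForthStep
  s₁ = forth {W = []} iso (λ _ ()) n
  s₂ = forth {W = []} (IsPartialIso-swap (isPartialIso s₁)) (λ _ ()) n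

extend-to-automorphism : ∀ {L} → IsPartialIso E L →
                         Σ (V → V) λ α → IsAut α × (∀ {a b} → (a , b) ∈ L → α a ≡ b)
extend-to-automorphism {L} iso = α , (β , βα , αβ , αE) , extends
  where
  stage : ℕ → Σ (List (V × V)) (IsPartialIso E)
  step : ∀ n → BackAndForthStep (proj₁ (stage n)) n
  stage zero    = L , iso
  stage (suc n) = BackAndForthStep.graph (step n) , BackAndForthStep.isPartialIso (step n)
  step n = backAndForth (proj₂ (stage n)) n

  α β : V → V
  α n = BackAndForthStep.image (step n)
  β n = BackAndForthStep.preimage (step n)

  compatible : ∀ {p q} i j → p ∈ proj₁ (stage i) → q ∈ proj₁ (stage j) → Compatible E p q
  compatible = chain-compatible {E} (proj₁ ∘ stage) (BackAndForthStep.extends ∘ step) (proj₂ ∘ stage)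

  forward : ∀ x → (x , α x) ∈ proj₁ (stage (suc x))
  forward x = BackAndForthStep.forward (step x)

  backward : ∀ x → (β x , x) ∈ proj₁ (stage (suc x))
  backward x = BackAndForthStep.backward (step x)

  βα : ∀ x → β (α x) ≡ x
  βα x = Compatible.injective (compatible (suc (α x)) (suc x) (backward (α x)) (forward x)) refl

  αβ : ∀ x → α (β x) ≡ x
  αβ x = Compatible.functional (compatible (suc (β x)) (suc x) (forward (β x)) (backward x)) refl

  αE : ∀ x y → E x y ⇔ E (α x) (α y)
  αE x y = mk⇔ (Compatible.preserves c) (Compatible.reflects c)
    where c = compatible (suc x) (suc y) (forward x) (forward y)

  extends : ∀ {a b} → (a , b) ∈ L → α a ≡ b
  extends {a} ab∈L = Compatible.functional (compatible (suc a) 0 (forward a) ab∈L) refl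

IsAut-injective : ∀ {α} → IsAut α → Injective _≡_ _≡_ α
IsAut-injective {α} (β , βα , _) {x} {y} αx≡αy = trans (sym (βα x)) (trans (cong β αx≡αy) (βα y))

IsAut-edges : ∀ {α} → IsAut α → ∀ x y → E x y ⇔ E (α x) (α y)
IsAut-edges (_ , _ , _ , edges) = edges

automorphism-mapping : ∀ x y → Σ (V → V) λ α → IsAut α × α x ≡ y
automorphism-mapping x y =
  let α , isAut , extends = extend-to-automorphism (IsPartialIso-∷ {x , y} {[]} (λ ()) (λ ()))
  in α , isAut , extends (here refl)

-- A binary injection of type min

unpair-next : ℕ × ℕ → ℕ × ℕ
unpair-next (x , zero)  = 0 , suc x
unpair-next (x , suc y) = suc x , y

unpair : ℕ → ℕ × ℕ
unpair zero    = 0 , 0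
unpair (suc n) = unpair-next (unpair n)

unpair-onto : ∀ s x y → x + y ≡ s → Σ ℕ λ n → unpair n ≡ (x , y)
unpair-onto zero    zero    zero    _ = 0 , refl
unpair-onto (suc s) zero    (suc s) refl with unpair-onto s s 0 (+-identityʳ s)
... | n , eq = suc n , cong unpair-next eq
unpair-onto (suc s) (suc x) y       eq with unpair-onto (suc s) x (suc y) (trans (+-suc x y) eq)
... | n , eq = suc n , cong unpair-next eq

pair : ℕ × ℕ → ℕ
pair (x , y) = proj₁ (unpair-onto (x + y) x y refl)

unpair-pair : ∀ p → unpair (pair p) ≡ p
unpair-pair (x , y) = proj₂ (unpair-onto (x + y) x y refl)

MinEdge : V² → V² → Set
MinEdge a b = E (proj₁ a) (proj₁ b) × E (proj₂ a) (proj₂ b)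

min-injection : Σ (V² → V) λ M → Injective _≡_ _≡_ M × (∀ a b → E (M a) (M b) ⇔ MinEdge a b)
min-injection = m ∘ pair , M-injective , M-edges
  where
  R : ℕ → ℕ → Set
  R i j = MinEdge (unpair i) (unpair j)

  module Min = PartialIso {R} (λ i j → E? _ _ ×-dec E? _ _)
                              (λ i (e , _) → E-irrefl _ e) (λ (e₁ , e₂) → E-sym e₁ , E-sym e₂)

  m : ℕ → V
  m = proj₁ (Min.embedding [])

  open Min.IsEmbedding (proj₁ (proj₂ (Min.embedding [])))

  M-injective : Injective _≡_ _≡_ (m ∘ pair)
  M-injective {a} {b} eq =
    trans (sym (unpair-pair a)) (trans (cong unpair (injective {pair a} {pair b} eq)) (unpair-pair b))

  M-edges : ∀ a b → E (m (pair a)) (m (pair b)) ⇔ MinEdge a b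
  M-edges a b = begin
    E (m (pair a)) (m (pair b))                  ≈⟨ edges (pair a) (pair b) ⟨
    MinEdge (unpair (pair a)) (unpair (pair b))  ≡⟨ cong₂ MinEdge (unpair-pair a) (unpair-pair b) ⟩
    MinEdge a b                                  ∎
    where
      open ⇔-Reasoning

module _ {f : V² → V} where

  generates-proj₁ : Generates f proj₁
  generates-proj₁ = gen-proj 2 zero

  generates-proj₂ : Generates f proj₂
  generates-proj₂ = gen-proj 2 (suc zero)

  generates-pair : ∀ {F H₁ H₂} → Generates f F → Generates f H₁ → Generates f H₂ →
                   Generates f (λ p → F (H₁ p , H₂ p))
  generates-pair {F} {H₁} {H₂} gF gH₁ gH₂ = gen-comp 2 2 _ args gF gargs
    where
    args : Fin 2 → Op 2
    args zero       x = H₁ (x zero , x (suc zero))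
    args (suc zero) x = H₂ (x zero , x (suc zero))

    gargs : ∀ i → Gen f 2 (args i)
    gargs zero       = gH₁
    gargs (suc zero) = gH₂

  generates-aut : ∀ {α H} → IsAut α → Generates f H → Generates f (α ∘ H)
  generates-aut {α} {H} isAut gH = gen-comp 1 2 _ (λ _ x → H (x zero , x (suc zero))) (gen-aut α isAut) (λ _ → gH)

InjectiveOn : List V² → (V² → V) → Set
InjectiveOn A H = ∀ {x y} → x ∈ A → y ∈ A → H x ≡ H y → x ≡ y

InjectiveOn-agree : ∀ {A H K} → (∀ {a} → a ∈ A → H a ≡ K a) → Injective _≡_ _≡_ K → InjectiveOn A H
InjectiveOn-agree H≡K K-injective x∈A y∈A Hx≡Hy = K-injective (trans (sym (H≡K x∈A)) (trans Hx≡Hy (H≡K y∈A)))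

SameEdgesOn : List V² → (V² → V) → (V² → V) → Set
SameEdgesOn A H K = ∀ {x y} → x ∈ A → y ∈ A → x ≢ y → E (H x) (H y) ⇔ E (K x) (K y)

graph-isPartialIso : ∀ {A H K} → InjectiveOn A H → Injective _≡_ _≡_ K → SameEdgesOn A H K →
                     IsPartialIso E (map (λ a → H a , K a) A)
graph-isPartialIso {A} {H} {K} H-injective K-injective same p∈ q∈ with ∈-map⁻ _ p∈ | ∈-map⁻ _ q∈
... | a , a∈A , refl | b , b∈A , refl = compatible (a ≟² b)
  where
  compatible : Dec (a ≡ b) → Compatible E (H a , K a) (H b , K b)
  compatible (yes refl) = Compatible-refl _
  compatible (no a≢b)   = record
    { functional = cong K ∘ H-injective a∈A b∈A ; injective = cong H ∘ K-injective
    ; preserves = Equivalence.to (same a∈A b∈A a≢b) ; reflects = Equivalence.from (same a∈A b∈A a≢b) }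

-- By homogeneity of G, a generated map with the isomorphism type of g on A
-- can be corrected by an automorphism so as to agree with g on A.
generates-if-locally-isomorphic :
  ∀ {f} (g : V² → V) → Injective _≡_ _≡_ g →
  (∀ A → Σ (V² → V) λ H → Generates f H × InjectiveOn A H × SameEdgesOn A H g) →
  Generates f g
generates-if-locally-isomorphic {f} g g-injective local =
  gen-local 2 _ λ A → let h , gh , agrees = agreeing (map toPair A) in
                      h ∘ toPair , gh , λ a a∈A → agrees (∈-map⁺ toPair a∈A)
  where
  toPair : (Fin 2 → V) → V²
  toPair x = x zero , x (suc zero)

  agreeing : (A : List V²) → Σ (V² → V) λ h → Generates f h × (∀ {a} → a ∈ A → h a ≡ g a)
  agreeing A =
    let H , gH , H-injective , same = local A
        σ , σ-aut , σ-extends = extend-to-automorphism (graph-isPartialIso H-injective g-injective same)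
    in σ ∘ H , generates-aut {H = H} σ-aut gH , σ-extends ∘ ∈-map⁺ _

⇔-×-implied : ∀ {P Q D : Set} → D → (P × Q) ⇔ (P × (D → Q))
⇔-×-implied d = mk⇔ (λ (p , q) → p , const q) (λ (p , q) → p , q d)

⇔-×-vacuous : ∀ {P Q D : Set} → ¬ D → P ⇔ (P × (D → Q))
⇔-×-vacuous ¬d = mk⇔ (λ p → p , ⊥-elim ∘ ¬d) proj₁

module Construction (u : V²) (f : V² → V) (f-injective : BinaryInjection f)
                    (like-p₁ : ∀ v w → InU u v → InU u w → BehavesP1 f v w)
                    (like-min : ∀ v → InU u v → BehavesMin f u v) where

  open ⇔-Reasoning

  u₁ u₂ : V
  u₁ = proj₁ u
  u₂ = proj₂ u

  module MinStep (A : List V²) (H T : V² → V) (H-injective : InjectiveOn A H) (T-injective : InjectiveOn A T)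
                 (a : V²) (a∈A : a ∈ A) where

    α β : V → V
    α = proj₁ (automorphism-mapping (H a) u₁)
    β = proj₁ (automorphism-mapping (T a) u₂)

    α-aut : IsAut α
    α-aut = proj₁ (proj₂ (automorphism-mapping (H a) u₁))
    β-aut : IsAut β
    β-aut = proj₁ (proj₂ (automorphism-mapping (T a) u₂))

    αHa≡u₁ : α (H a) ≡ u₁
    αHa≡u₁ = proj₂ (proj₂ (automorphism-mapping (H a) u₁))
    βTa≡u₂ : β (T a) ≡ u₂
    βTa≡u₂ = proj₂ (proj₂ (automorphism-mapping (T a) u₂))

    moved : V² → V²
    moved p = α (H p) , β (T p)

    H′ : V² → V
    H′ = f ∘ moved

    moved-a : moved a ≡ u
    moved-a = ×-≡,≡→≡ (αHa≡u₁ , βTa≡u₂)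

    moved₁-injective : ∀ {x y} → x ∈ A → y ∈ A → proj₁ (moved x) ≡ proj₁ (moved y) → x ≡ y
    moved₁-injective x∈A y∈A = H-injective x∈A y∈A ∘ IsAut-injective α-aut

    moved₂-injective : ∀ {x y} → x ∈ A → y ∈ A → proj₂ (moved x) ≡ proj₂ (moved y) → x ≡ y
    moved₂-injective x∈A y∈A = T-injective x∈A y∈A ∘ IsAut-injective β-aut

    moved-inU : ∀ {x} → x ∈ A → x ≢ a → InU u (moved x)
    moved-inU x∈A x≢a = (λ eq → x≢a (moved₁-injective x∈A a∈A (trans eq (sym αHa≡u₁))))
                      , (λ eq → x≢a (moved₂-injective x∈A a∈A (trans eq (sym βTa≡u₂))))

    H′-injective : InjectiveOn A H′
    H′-injective x∈A y∈A = moved₁-injective x∈A y∈A ∘ proj₁ ∘ ×-≡,≡←≡ ∘ f-injective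

    H′-edges-a : ∀ {y} → y ∈ A → y ≢ a → E (H′ a) (H′ y) ⇔ (E (H a) (H y) × E (T a) (T y))
    H′-edges-a {y} y∈A y≢a = begin
      E (H′ a) (H′ y)
        ≡⟨ cong (λ v → E (f v) (H′ y)) moved-a ⟩
      E (f u) (f (moved y))
        ≈⟨ like-min (moved y) inU (proj₁ inU ∘ sym) (proj₂ inU ∘ sym) ⟩
      (E u₁ (α (H y)) × E u₂ (β (T y)))
        ≡⟨ cong₂ (λ v w → E v (α (H y)) × E w (β (T y))) (sym αHa≡u₁) (sym βTa≡u₂) ⟩
      (E (α (H a)) (α (H y)) × E (β (T a)) (β (T y)))
        ≈⟨ IsAut-edges α-aut (H a) (H y) ×-⇔ IsAut-edges β-aut (T a) (T y) ⟨
      (E (H a) (H y) × E (T a) (T y))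
        ∎
      where inU = moved-inU y∈A y≢a

    H′-edges-away : ∀ {x y} → x ∈ A → y ∈ A → x ≢ y → x ≢ a → y ≢ a →
                    E (H′ x) (H′ y) ⇔ E (H x) (H y)
    H′-edges-away {x} {y} x∈A y∈A x≢y x≢a y≢a = begin
      E (H′ x) (H′ y)       ≈⟨ like-p₁ (moved x) (moved y) (moved-inU x∈A x≢a) (moved-inU y∈A y≢a)
                                 (x≢y ∘ moved₁-injective x∈A y∈A) (x≢y ∘ moved₂-injective x∈A y∈A) ⟩
      E (α (H x)) (α (H y)) ≈⟨ IsAut-edges α-aut (H x) (H y) ⟨
      E (H x) (H y)         ∎

    H′-edges : ∀ {x y} → x ∈ A → y ∈ A → x ≢ y →
               E (H′ x) (H′ y) ⇔ (E (H x) (H y) × (x ≡ a ⊎ y ≡ a → E (T x) (T y)))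
    H′-edges {x} {y} x∈A y∈A x≢y with x ≟² a | y ≟² a
    ... | yes refl | yes refl = ⊥-elim (x≢y refl)
    ... | yes refl | no y≢a  = ⇔-trans (H′-edges-a y∈A y≢a) (⇔-×-implied (inj₁ refl))
    ... | no x≢a   | yes refl = begin
          E (H′ x) (H′ a)                                  ≈⟨ E-sym⇔ ⟩
          E (H′ a) (H′ x)                                  ≈⟨ H′-edges-a x∈A x≢a ⟩
          (E (H a) (H x) × E (T a) (T x))                  ≈⟨ E-sym⇔ ×-⇔ E-sym⇔ ⟩
          (E (H x) (H a) × E (T x) (T a))                  ≈⟨ ⇔-×-implied (inj₂ refl) ⟩
          (E (H x) (H a) × (x ≡ a ⊎ a ≡ a → E (T x) (T a))) ∎
    ... | no x≢a   | no y≢a  =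
          ⇔-trans (H′-edges-away x∈A y∈A x≢y x≢a y≢a)
                  (⇔-×-vacuous λ { (inj₁ x≡a) → x≢a x≡a ; (inj₂ y≡a) → y≢a y≡a })

  -- The invariant while the points of B are treated one by one: H behaves
  -- like G at every pair, and like min (G , T) at every pair meeting B.
  module Approximation (A : List V²) (G T : V² → V) (gG : Generates f G) (gT : Generates f T)
                       (G-injective : InjectiveOn A G) (T-injective : InjectiveOn A T) where

    record Approximates (B : List V²) (H : V² → V) : Set where
      field
        generated   : Generates f H
        injectiveOn : InjectiveOn A H
        sound       : ∀ {x y} → x ∈ A → y ∈ A → x ≢ y → E (H x) (H y) → E (G x) (G y)
        complete    : ∀ {x y} → x ∈ A → y ∈ A → x ≢ y → E (G x) (G y) → E (T x) (T y) → E (H x) (H y)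
        exact       : ∀ {x y} → x ∈ A → y ∈ B → x ≢ y → E (H x) (H y) → E (T x) (T y)

    approximate-∷ : ∀ {a B} → a ∷ B ⊆ A → Σ (V² → V) (Approximates B) → Σ (V² → V) (Approximates (a ∷ B))
    approximate-∷ {a} a∷B⊆A (H , approx) = H′ , record
      { generated = generates-pair {F = f} {H₁ = α ∘ H} {H₂ = β ∘ T} gen-f
                      (generates-aut {H = H} α-aut generated) (generates-aut {H = T} β-aut gT)
      ; injectiveOn = H′-injective
      ; sound = λ x∈A y∈A x≢y → sound x∈A y∈A x≢y ∘ proj₁ ∘ Equivalence.to (H′-edges x∈A y∈A x≢y)
      ; complete = λ x∈A y∈A x≢y g t →
          Equivalence.from (H′-edges x∈A y∈A x≢y) (complete x∈A y∈A x≢y g t , const t)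
      ; exact = λ where
          x∈A (here refl) x≢y e →
            proj₂ (Equivalence.to (H′-edges x∈A (a∷B⊆A (here refl)) x≢y) e) (inj₂ refl)
          x∈A (there y∈B) x≢y e →
            exact x∈A y∈B x≢y (proj₁ (Equivalence.to (H′-edges x∈A (a∷B⊆A (there y∈B)) x≢y) e)) }
      where
      open Approximates approx
      open MinStep A H T injectiveOn T-injective a (a∷B⊆A (here refl))

    approximate : (B : List V²) → B ⊆ A → Σ (V² → V) (Approximates B)
    approximate []      _      = G , record
      { generated = gG ; injectiveOn = G-injective
      ; sound = λ _ _ _ → id ; complete = λ _ _ _ g _ → g ; exact = λ _ () }
    approximate (a ∷ B) a∷B⊆A = approximate-∷ a∷B⊆A (approximate B (a∷B⊆A ∘ there))

    min-approximation : Σ (V² → V) λ H → Generates f H × InjectiveOn A H ×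
                        (∀ {x y} → x ∈ A → y ∈ A → x ≢ y → E (H x) (H y) ⇔ (E (G x) (G y) × E (T x) (T y)))
    min-approximation = H , generated , injectiveOn , λ x∈A y∈A x≢y →
      mk⇔ (λ e → sound x∈A y∈A x≢y e , exact x∈A y∈A x≢y e) (λ (g , t) → complete x∈A y∈A x≢y g t)
      where
      H : V² → V
      H = proj₁ (approximate A id)
      open Approximates (proj₂ (approximate A id))

  e : V → V
  e = proj₁ (embedding (u₁ ∷ u₂ ∷ []))

  open IsEmbedding (proj₁ (proj₂ (embedding (u₁ ∷ u₂ ∷ [])))) renaming (injective to e-injective; edges to e-edges)

  e-inU : ∀ x y → InU u (e x , e y)
  e-inU x y = (λ ex≡u₁ → avoids x (here ex≡u₁)) , (λ ey≡u₂ → avoids y (there (here ey≡u₂)))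
    where avoids = proj₂ (proj₂ (embedding (u₁ ∷ u₂ ∷ [])))

  -- Since e maps into U, g₁ behaves like p₁ and g₂ like p₂ everywhere.
  g₁ g₂ : V² → V
  g₁ (x , y) = f (e x , e y)
  g₂ = g₁ ∘ swap

  g₁-injective : Injective _≡_ _≡_ g₁
  g₁-injective eq with ×-≡,≡←≡ (f-injective eq)
  ... | x≡ , y≡ = ×-≡,≡→≡ (e-injective x≡ , e-injective y≡)

  g₂-injective : Injective _≡_ _≡_ g₂
  g₂-injective = cong swap ∘ g₁-injective

  g₁-edges : ∀ a b → proj₁ a ≢ proj₁ b → proj₂ a ≢ proj₂ b → E (g₁ a) (g₁ b) ⇔ E (proj₁ a) (proj₁ b)
  g₁-edges (a₁ , a₂) (b₁ , b₂) a₁≢b₁ a₂≢b₂ = begin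
    E (g₁ (a₁ , a₂)) (g₁ (b₁ , b₂))  ≈⟨ like-p₁ _ _ (e-inU a₁ a₂) (e-inU b₁ b₂)
                                                (a₁≢b₁ ∘ e-injective) (a₂≢b₂ ∘ e-injective) ⟩
    E (e a₁) (e b₁)                  ≈⟨ e-edges a₁ b₁ ⟨
    E a₁ b₁                          ∎

  g : V² → V
  g p = proj₁ min-injection (g₁ p , g₂ p)

  g-edges : ∀ a b → E (g a) (g b) ⇔ (E (g₁ a) (g₁ b) × E (g₂ a) (g₂ b))
  g-edges a b = proj₂ (proj₂ min-injection) (g₁ a , g₂ a) (g₁ b , g₂ b)

  typeMin : TypeMin g
  typeMin = g₁-injective ∘ proj₁ ∘ ×-≡,≡←≡ ∘ proj₁ (proj₂ min-injection)
          , λ a b a₁≢b₁ a₂≢b₂ → ⇔-trans (g-edges a b)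
                                  (g₁-edges a b a₁≢b₁ a₂≢b₂ ×-⇔ g₁-edges (swap a) (swap b) a₂≢b₂ a₁≢b₁)

  -- e is not an automorphism, so on a finite A it is replaced by one, γ,
  -- agreeing with e on the coordinates of points of A.
  module Local (A : List V²) where

    coordinates : List V
    coordinates = map proj₁ A ++ map proj₂ A

    fst∈coordinates : ∀ {a} → a ∈ A → proj₁ a ∈ coordinates
    fst∈coordinates = ∈-++⁺ˡ ∘ ∈-map⁺ proj₁

    snd∈coordinates : ∀ {a} → a ∈ A → proj₂ a ∈ coordinates
    snd∈coordinates = ∈-++⁺ʳ _ ∘ ∈-map⁺ proj₂

    e-graph-isPartialIso : IsPartialIso E (map (λ v → v , e v) coordinates)
    e-graph-isPartialIso p∈ q∈ with ∈-map⁻ _ p∈ | ∈-map⁻ _ q∈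
    ... | v , _ , refl | w , _ , refl = record
      { functional = cong e ; injective = e-injective
      ; preserves = Equivalence.to (e-edges v w) ; reflects = Equivalence.from (e-edges v w) }

    γ : V → V
    γ = proj₁ (extend-to-automorphism e-graph-isPartialIso)

    γ-aut : IsAut γ
    γ-aut = proj₁ (proj₂ (extend-to-automorphism e-graph-isPartialIso))

    γ≡e : ∀ {v} → v ∈ coordinates → γ v ≡ e v
    γ≡e = proj₂ (proj₂ (extend-to-automorphism e-graph-isPartialIso)) ∘ ∈-map⁺ _

    G T : V² → V
    G (x , y) = f (γ x , γ y)
    T = G ∘ swap

    G-generated : Generates f G
    G-generated = generates-pair {F = f} {H₁ = γ ∘ proj₁} {H₂ = γ ∘ proj₂} gen-f
                    (generates-aut {H = proj₁} γ-aut generates-proj₁)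
                    (generates-aut {H = proj₂} γ-aut generates-proj₂)

    G≡g₁ : ∀ {a} → a ∈ A → G a ≡ g₁ a
    G≡g₁ a∈A = cong₂ (λ x y → f (x , y)) (γ≡e (fst∈coordinates a∈A)) (γ≡e (snd∈coordinates a∈A))

    T≡g₂ : ∀ {a} → a ∈ A → T a ≡ g₂ a
    T≡g₂ a∈A = cong₂ (λ x y → f (x , y)) (γ≡e (snd∈coordinates a∈A)) (γ≡e (fst∈coordinates a∈A))

    T-generated : Generates f T
    T-generated = generates-pair {F = G} {H₁ = proj₂} {H₂ = proj₁} G-generated generates-proj₂ generates-proj₁

    open Approximation A G T G-generated T-generated
                       (InjectiveOn-agree G≡g₁ g₁-injective) (InjectiveOn-agree T≡g₂ g₂-injective)

    locally-generated : Σ (V² → V) λ H → Generates f H × InjectiveOn A H × SameEdgesOn A H g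
    locally-generated =
      let H , H-generated , H-injective , H-edges = min-approximation in
      H , H-generated , H-injective , λ {x} {y} x∈A y∈A x≢y → begin
      E (H x) (H y)                        ≈⟨ H-edges x∈A y∈A x≢y ⟩
      (E (G x) (G y) × E (T x) (T y))      ≡⟨ cong₂ _×_ (cong₂ E (G≡g₁ x∈A) (G≡g₁ y∈A))
                                                        (cong₂ E (T≡g₂ x∈A) (T≡g₂ y∈A)) ⟩
      (E (g₁ x) (g₁ y) × E (g₂ x) (g₂ y))  ≈⟨ g-edges x y ⟨
      E (g x) (g y)                        ∎

  generates : Generates f g
  generates = generates-if-locally-isomorphic g (proj₁ typeMin) (Local.locally-generated)

mainTheorem14 : (u : V²) (f : V² → V) →
    BinaryInjection f →
    Preserves E f →
    Preserves N f →
    (∀ v w → InU u v → InU u w → BehavesP1 f v w) →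
    (∀ v → InU u v → BehavesMin f u v) →
    Σ (V² → V) λ g → Generates f g × TypeMin g
mainTheorem14 u f f-injective _ _ like-p₁ like-min = g , generates , typeMin
  where
    open Construction u f f-injective like-p₁ like-min
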